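{- Let $H$ be a natural number and $X>0$ a real number with $H\leqslant X/4$. For natural $h$ define $$S(X,h)=\sum_{n\leqslant X}\varepsilon(n)\varepsilon(n+h).$$ Then $$\sum_{h=1}^{H}|S(X,h)|=O\big(X\,H^{\mu}\big),\qquad \mu=\frac{\ln 3.5}{\ln 4}=0.903\ldots,$$ where the constant implied by $O$ is absolute.
   Context: For a natural number $m$, $\varepsilon(m)=1$ if the binary expansion of $m$ contains an even number of ones, and $\varepsilon(m)=-1$ if it contains an odd number of ones. -}

module Defs where

open import Data.Nat using (ℕ; zero; suc; _+_; _/_; _%_)
open import Data.Integer using (ℤ; +_; -_) renaming (_+_ to _+ℤ_; _*_ to _*ℤ_)
open import Data.Integer using (∣_∣)

-- Number of ones in the binary expansion of m.
-- `go f m` extracts f binary digits of m; fuel m suffices since m < 2^m.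
onesFuel : ℕ → ℕ → ℕ
onesFuel zero    _ = 0
onesFuel (suc f) m = m % 2 + onesFuel f (m / 2)

ones : ℕ → ℕ
ones m = onesFuel m m

signPow : ℕ → ℤ
signPow zero    = + 1
signPow (suc k) = - signPow k

ε : ℕ → ℤ
ε m = signPow (ones m)

sumℤ1 : ℕ → (ℕ → ℤ) → ℤ
sumℤ1 zero    f = + 0
sumℤ1 (suc N) f = sumℤ1 N f +ℤ f (suc N)

sumℕ1 : ℕ → (ℕ → ℕ) → ℕ
sumℕ1 zero    g = 0
sumℕ1 (suc H) g = sumℕ1 H g + g (suc H)

-- S(X,h) = Σ_{1 ≤ n ≤ X} ε(n) ε(n+h), depending only on N = ⌊X⌋
S : ℕ → ℕ → ℤ
S N h = sumℤ1 N (λ n → ε n *ℤ ε (n + h))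

T : ℕ → ℕ → ℕ
T N H = sumℕ1 H (λ h → ∣ S N h ∣)

{-# OPTIONS --safe #-}
module Submission where

open import Defs
open import Data.Nat using (ℕ; zero; suc; _+_; _*_; _^_; _≤_; _<_; z≤n; s≤s; s≤s⁻¹; _/_; _%_; _≤?_;
  NonZero; _≤′_; ≤′-reflexive; ≤′-step)
open import Data.Nat.Properties
open import Algebra.Properties.CommutativeSemigroup +-commutativeSemigroup using () renaming (interchange to +-interchange)
open import Algebra.Properties.CommutativeSemigroup *-commutativeSemigroup using () renaming (interchange to *-interchange)
open import Data.Nat.DivMod
open import Data.Nat.Divisibility using (n∣m*n)
open import Data.Integer as ℤ using (ℤ; -_; ∣_∣)
import Data.Integer.Properties as ℤ
import Data.Integer.Tactic.RingSolver as ℤ-Solver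
import Data.Nat.Tactic.RingSolver as ℕ-Solver
open import Data.Product using (∃-syntax; _×_; _,_)
open import Data.Sum using (inj₁; inj₂)
open import Function using (_∘_)
open import Relation.Nullary using (yes; no)
open import Relation.Binary.PropositionalEquality

-- Write corr N h = Σ_{n<N} ε(n) ε(n+h). The digit recursions ε(2n) = ε(n), ε(2n+1) = -ε(n) give
-- corr(2M,2h) = 2 corr(M,h) and corr(2M,2h+1) = -corr(M,h) - corr(M,h+1). Applied twice, the shifts
-- 4g, 4g+1, 4g+2, 4g+3 at length 4M have correlations 4a, b-a, -2(a+b), a-b, where a = corr(M,g) and
-- b = corr(M,g+1), so their absolute values total at most 8|a| + 4|b|. Quartering both the length and
-- the number of shifts therefore divides Σ_h |corr| by 12 instead of the trivial 16, which gives
-- Σ_{h≤H} |S(N,h)| ≪ N H^(log₄ 3). As log₄ 3 < μ, the stated bound follows with C = 48.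

onesFuel-zero : ∀ f → onesFuel f 0 ≡ 0
onesFuel-zero zero    = refl
onesFuel-zero (suc f) = onesFuel-zero f

m≤1+n⇒m/2≤n : ∀ {m n} → m ≤ suc n → m / 2 ≤ n
m≤1+n⇒m/2≤n {zero}  _   = z≤n
m≤1+n⇒m/2≤n {suc m} m≤n = s≤s⁻¹ (<-≤-trans (m/n<m (suc m) 2 (s≤s (s≤s z≤n))) m≤n)

onesFuel-stable : ∀ f g m → m ≤ f → m ≤ g → onesFuel f m ≡ onesFuel g m
onesFuel-stable zero    g       .zero z≤n _   = sym (onesFuel-zero g)
onesFuel-stable (suc f) zero    .zero _   z≤n = onesFuel-zero (suc f)
onesFuel-stable (suc f) (suc g) m     m≤f m≤g =
  cong (m % 2 +_) (onesFuel-stable f g (m / 2) (m≤1+n⇒m/2≤n m≤f) (m≤1+n⇒m/2≤n m≤g))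

ones-unfold : ∀ m → ones m ≡ m % 2 + ones (m / 2)
ones-unfold zero    = refl
ones-unfold (suc m) = cong (suc m % 2 +_) (onesFuel-stable m (suc m / 2) (suc m / 2) (m≤1+n⇒m/2≤n ≤-refl) ≤-refl)

ε-even : ∀ m → ε (m * 2) ≡ ε m
ε-even m = cong signPow (begin
  ones (m * 2)                 ≡⟨ ones-unfold (m * 2) ⟩
  m * 2 % 2 + ones (m * 2 / 2) ≡⟨ cong₂ _+_ (m*n%n≡0 m 2) (cong ones (m*n/n≡m m 2)) ⟩
  ones m                       ∎)
  where open ≡-Reasoning

ε-odd : ∀ m → ε (suc (m * 2)) ≡ - ε m
ε-odd m = cong signPow (begin
  ones (1 + m * 2)                       ≡⟨ ones-unfold (1 + m * 2) ⟩
  (1 + m * 2) % 2 + ones ((1 + m * 2) / 2) ≡⟨ cong₂ _+_ ([m+kn]%n≡m%n 1 m 2) (cong ones half) ⟩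
  1 + ones m                             ∎)
  where
  open ≡-Reasoning
  half : (1 + m * 2) / 2 ≡ m
  half = trans (+-distrib-/-∣ʳ 1 {d = 2} (n∣m*n m)) (m*n/n≡m m 2)

∣signPow∣≡1 : ∀ k → ∣ signPow k ∣ ≡ 1
∣signPow∣≡1 zero    = refl
∣signPow∣≡1 (suc k) = trans (ℤ.∣-i∣≡∣i∣ (signPow k)) (∣signPow∣≡1 k)

∣ε∣≡1 : ∀ m → ∣ ε m ∣ ≡ 1
∣ε∣≡1 m = ∣signPow∣≡1 (ones m)

∣ε*ε∣≡1 : ∀ m n → ∣ ε m ℤ.* ε n ∣ ≡ 1
∣ε*ε∣≡1 m n = trans (ℤ.∣i*j∣≡∣i∣*∣j∣ (ε m) (ε n)) (cong₂ _*_ (∣ε∣≡1 m) (∣ε∣≡1 n))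

Σ< : ℕ → (ℕ → ℕ) → ℕ
Σ< zero    f = 0
Σ< (suc n) f = Σ< n f + f n

Σ<-mono-≤ : ∀ n {f g} → (∀ i → f i ≤ g i) → Σ< n f ≤ Σ< n g
Σ<-mono-≤ zero    f≤g = z≤n
Σ<-mono-≤ (suc n) f≤g = +-mono-≤ (Σ<-mono-≤ n f≤g) (f≤g n)

Σ<-monoˡ-≤ : ∀ f {m n} → m ≤ n → Σ< m f ≤ Σ< n f
Σ<-monoˡ-≤ f = go ∘ ≤⇒≤′
  where
  go : ∀ {m n} → m ≤′ n → Σ< m f ≤ Σ< n f
  go (≤′-reflexive refl) = ≤-refl
  go (≤′-step m≤n)       = ≤-trans (go m≤n) (m≤m+n _ _)

Σ<-const : ∀ n c → Σ< n (λ _ → c) ≡ n * c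
Σ<-const zero    c = refl
Σ<-const (suc n) c = trans (cong (_+ c) (Σ<-const n c)) (+-comm (n * c) c)

Σ<-distrib-+ : ∀ n f g → Σ< n (λ i → f i + g i) ≡ Σ< n f + Σ< n g
Σ<-distrib-+ zero    f g = refl
Σ<-distrib-+ (suc n) f g = trans (cong (_+ (f n + g n)) (Σ<-distrib-+ n f g)) (+-interchange (Σ< n f) (Σ< n g) (f n) (g n))

Σ<-distribˡ-* : ∀ n c f → Σ< n (λ i → c * f i) ≡ c * Σ< n f
Σ<-distribˡ-* zero    c f = sym (*-zeroʳ c)
Σ<-distribˡ-* (suc n) c f = trans (cong (_+ c * f n) (Σ<-distribˡ-* n c f)) (sym (*-distribˡ-+ c (Σ< n f) (f n)))

Σ<-suc : ∀ n f → Σ< (suc n) f ≡ f 0 + Σ< n (f ∘ suc)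
Σ<-suc zero    f = +-comm 0 (f 0)
Σ<-suc (suc n) f = trans (cong (_+ f (suc n)) (Σ<-suc n f)) (+-assoc (f 0) _ _)

Σ<-×4 : ∀ n f → Σ< (n * 2 * 2) f ≡ Σ< n (λ i → f (i * 2 * 2) + f (1 + i * 2 * 2) + f (2 + i * 2 * 2) + f (3 + i * 2 * 2))
Σ<-×4 zero    f = refl
Σ<-×4 (suc n) f = trans (regroup (Σ< (n * 2 * 2) f) _ _ _ _) (cong (_+ block) (Σ<-×4 n f))
  where
  block : ℕ
  block = f (n * 2 * 2) + f (1 + n * 2 * 2) + f (2 + n * 2 * 2) + f (3 + n * 2 * 2)
  regroup : ∀ s a b c d → s + a + b + c + d ≡ s + (a + b + c + d)
  regroup = ℕ-Solver.solve-∀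

Σ<-neighbours : ∀ n p q x → Σ< n (λ i → p * x i + q * x (suc i)) ≤ (p + q) * Σ< (suc n) x
Σ<-neighbours n p q x = begin
  Σ< n (λ i → p * x i + q * x (suc i))   ≡⟨ Σ<-distrib-+ n _ _ ⟩
  Σ< n (λ i → p * x i) + Σ< n (λ i → q * x (suc i))
                                         ≡⟨ cong₂ _+_ (Σ<-distribˡ-* n p x) (Σ<-distribˡ-* n q (x ∘ suc)) ⟩
  p * Σ< n x + q * Σ< n (x ∘ suc)        ≤⟨ +-mono-≤ (*-monoʳ-≤ p (m≤m+n _ _)) (*-monoʳ-≤ q tail≤) ⟩
  p * Σ< (suc n) x + q * Σ< (suc n) x    ≡⟨ *-distribʳ-+ (Σ< (suc n) x) p q ⟨
  (p + q) * Σ< (suc n) x                 ∎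
  where
  open ≤-Reasoning
  tail≤ : Σ< n (x ∘ suc) ≤ Σ< (suc n) x
  tail≤ = ≤-trans (m≤n+m _ (x 0)) (≤-reflexive (sym (Σ<-suc n x)))

corr : ℕ → ℕ → ℤ
corr zero    h = ℤ.0ℤ
corr (suc M) h = corr M h ℤ.+ ε M ℤ.* ε (M + h)

corr-even : ∀ M h → corr (M * 2) (h * 2) ≡ corr M h ℤ.+ corr M h
corr-even zero    h = refl
corr-even (suc M) h
  rewrite sym (*-distribʳ-+ 2 M h) | ε-even (M + h) | ε-odd (M + h) | ε-even M | ε-odd M | corr-even M h
  = step (corr M h) (ε M) (ε (M + h))
  where
  step : ∀ c e f → c ℤ.+ c ℤ.+ e ℤ.* f ℤ.+ (- e) ℤ.* (- f) ≡ (c ℤ.+ e ℤ.* f) ℤ.+ (c ℤ.+ e ℤ.* f)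
  step = ℤ-Solver.solve-∀

m*2+[1+n*2]≡1+[m+n]*2 : ∀ m n → m * 2 + suc (n * 2) ≡ suc ((m + n) * 2)
m*2+[1+n*2]≡1+[m+n]*2 m n = trans (+-suc (m * 2) (n * 2)) (cong suc (sym (*-distribʳ-+ 2 m n)))

ε-2m+2n+1 : ∀ m n → ε (m * 2 + suc (n * 2)) ≡ - ε (m + n)
ε-2m+2n+1 m n = trans (cong ε (m*2+[1+n*2]≡1+[m+n]*2 m n)) (ε-odd (m + n))

ε-2m+2n+2 : ∀ m n → ε (suc (m * 2 + suc (n * 2))) ≡ ε (m + suc n)
ε-2m+2n+2 m n = begin
  ε (suc (m * 2 + suc (n * 2))) ≡⟨ cong (ε ∘ suc) (m*2+[1+n*2]≡1+[m+n]*2 m n) ⟩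
  ε (suc (m + n) * 2)           ≡⟨ ε-even (suc (m + n)) ⟩
  ε (suc (m + n))               ≡⟨ cong ε (+-suc m n) ⟨
  ε (m + suc n)                 ∎
  where open ≡-Reasoning

corr-odd : ∀ M h → corr (M * 2) (suc (h * 2)) ≡ (- corr M h) ℤ.+ (- corr M (suc h))
corr-odd zero    h = refl
corr-odd (suc M) h
  rewrite ε-2m+2n+1 M h | ε-2m+2n+2 M h | ε-even M | ε-odd M | corr-odd M h
  = step (corr M h) (corr M (suc h)) (ε M) (ε (M + h)) (ε (M + suc h))
  where
  step : ∀ s t e f g → ((- s) ℤ.+ (- t) ℤ.+ e ℤ.* (- f)) ℤ.+ (- e) ℤ.* g ≡ (- (s ℤ.+ e ℤ.* f)) ℤ.+ (- (t ℤ.+ e ℤ.* g))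
  step = ℤ-Solver.solve-∀

∣-i+-j∣≤∣i∣+∣j∣ : ∀ i j → ∣ (- i) ℤ.+ (- j) ∣ ≤ ∣ i ∣ + ∣ j ∣
∣-i+-j∣≤∣i∣+∣j∣ i j = ≤-trans (ℤ.∣i+j∣≤∣i∣+∣j∣ (- i) (- j)) (≤-reflexive (cong₂ _+_ (ℤ.∣-i∣≡∣i∣ i) (ℤ.∣-i∣≡∣i∣ j)))

corr-4g+1 : ∀ M g → corr (M * 2 * 2) (1 + g * 2 * 2) ≡ corr M (suc g) ℤ.- corr M g
corr-4g+1 M g = trans (corr-odd (M * 2) (g * 2))
  (trans (cong₂ (λ x y → (- x) ℤ.+ (- y)) (corr-even M g) (corr-odd M g)) (simplify (corr M g) (corr M (suc g))))
  where
  simplify : ∀ a b → (- (a ℤ.+ a)) ℤ.+ (- ((- a) ℤ.+ (- b))) ≡ b ℤ.- a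
  simplify = ℤ-Solver.solve-∀

corr-4g+3 : ∀ M g → corr (M * 2 * 2) (3 + g * 2 * 2) ≡ corr M g ℤ.- corr M (suc g)
corr-4g+3 M g = trans (corr-odd (M * 2) (suc (g * 2)))
  (trans (cong₂ (λ x y → (- x) ℤ.+ (- y)) (corr-odd M g) (corr-even M (suc g))) (simplify (corr M g) (corr M (suc g))))
  where
  simplify : ∀ a b → (- ((- a) ℤ.+ (- b))) ℤ.+ (- (b ℤ.+ b)) ≡ a ℤ.- b
  simplify = ℤ-Solver.solve-∀

∣corr∣-block : ∀ M g →
  ∣ corr (M * 2 * 2) (g * 2 * 2) ∣ + ∣ corr (M * 2 * 2) (1 + g * 2 * 2) ∣ +
  ∣ corr (M * 2 * 2) (2 + g * 2 * 2) ∣ + ∣ corr (M * 2 * 2) (3 + g * 2 * 2) ∣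
    ≤ 8 * ∣ corr M g ∣ + 4 * ∣ corr M (suc g) ∣
∣corr∣-block M g = begin
  ∣ corr (M * 2 * 2) (g * 2 * 2) ∣ + ∣ corr (M * 2 * 2) (1 + g * 2 * 2) ∣ +
  ∣ corr (M * 2 * 2) (2 + g * 2 * 2) ∣ + ∣ corr (M * 2 * 2) (3 + g * 2 * 2) ∣
    ≡⟨ cong₂ _+_ (cong₂ _+_ (cong₂ _+_ (cong ∣_∣ corr-4g) (cong ∣_∣ (corr-4g+1 M g))) (cong ∣_∣ corr-4g+2))
                 (cong ∣_∣ (corr-4g+3 M g)) ⟩
  ∣ (a ℤ.+ a) ℤ.+ (a ℤ.+ a) ∣ + ∣ b ℤ.- a ∣ + ∣ c ℤ.+ c ∣ + ∣ a ℤ.- b ∣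
    ≤⟨ +-mono-≤ (+-mono-≤ (+-mono-≤ ∣4a∣≤ (ℤ.∣i-j∣≤∣i∣+∣j∣ b a)) ∣2c∣≤) (ℤ.∣i-j∣≤∣i∣+∣j∣ a b) ⟩
  ∣ a ∣ + ∣ a ∣ + (∣ a ∣ + ∣ a ∣) + (∣ b ∣ + ∣ a ∣) + (∣ a ∣ + ∣ b ∣ + (∣ a ∣ + ∣ b ∣)) + (∣ a ∣ + ∣ b ∣)
    ≡⟨ collect ∣ a ∣ ∣ b ∣ ⟩
  8 * ∣ a ∣ + 4 * ∣ b ∣ ∎
  where
  open ≤-Reasoning
  a b c : ℤ
  a = corr M g
  b = corr M (suc g)
  c = (- a) ℤ.+ (- b)
  corr-4g : corr (M * 2 * 2) (g * 2 * 2) ≡ (a ℤ.+ a) ℤ.+ (a ℤ.+ a)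
  corr-4g = trans (corr-even (M * 2) (g * 2)) (cong₂ ℤ._+_ (corr-even M g) (corr-even M g))
  corr-4g+2 : corr (M * 2 * 2) (2 + g * 2 * 2) ≡ c ℤ.+ c
  corr-4g+2 = trans (corr-even (M * 2) (suc (g * 2))) (cong₂ ℤ._+_ (corr-odd M g) (corr-odd M g))
  ∣4a∣≤ : ∣ (a ℤ.+ a) ℤ.+ (a ℤ.+ a) ∣ ≤ ∣ a ∣ + ∣ a ∣ + (∣ a ∣ + ∣ a ∣)
  ∣4a∣≤ = ≤-trans (ℤ.∣i+j∣≤∣i∣+∣j∣ (a ℤ.+ a) (a ℤ.+ a)) (+-mono-≤ (ℤ.∣i+j∣≤∣i∣+∣j∣ a a) (ℤ.∣i+j∣≤∣i∣+∣j∣ a a))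
  ∣2c∣≤ : ∣ c ℤ.+ c ∣ ≤ ∣ a ∣ + ∣ b ∣ + (∣ a ∣ + ∣ b ∣)
  ∣2c∣≤ = ≤-trans (ℤ.∣i+j∣≤∣i∣+∣j∣ c c) (+-mono-≤ (∣-i+-j∣≤∣i∣+∣j∣ a b) (∣-i+-j∣≤∣i∣+∣j∣ a b))
  collect : ∀ x y → x + x + (x + x) + (y + x) + (x + y + (x + y)) + (x + y) ≡ 8 * x + 4 * y
  collect = ℕ-Solver.solve-∀

Σ∣corr∣ : ℕ → ℕ → ℕ
Σ∣corr∣ M K = Σ< K (λ h → ∣ corr M h ∣)

Σ∣corr∣-×4 : ∀ M K → Σ∣corr∣ (M * 2 * 2) (K * 2 * 2) ≤ 12 * Σ∣corr∣ M (suc K)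
Σ∣corr∣-×4 M K = ≤-trans (≤-reflexive (Σ<-×4 K (λ h → ∣ corr (M * 2 * 2) h ∣)))
  (≤-trans (Σ<-mono-≤ K (∣corr∣-block M)) (Σ<-neighbours K 8 4 (λ h → ∣ corr M h ∣)))

∣corr-suc∣≤ : ∀ M h → ∣ corr (suc M) h ∣ ≤ suc ∣ corr M h ∣
∣corr-suc∣≤ M h = ≤-trans (ℤ.∣i+j∣≤∣i∣+∣j∣ (corr M h) (ε M ℤ.* ε (M + h)))
  (≤-reflexive (trans (cong (∣ corr M h ∣ +_) (∣ε*ε∣≡1 M (M + h))) (+-comm _ 1)))

∣corr-+∣≤ : ∀ r M h → ∣ corr (r + M) h ∣ ≤ r + ∣ corr M h ∣
∣corr-+∣≤ zero    M h = ≤-refl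
∣corr-+∣≤ (suc r) M h = ≤-trans (∣corr-suc∣≤ (r + M) h) (s≤s (∣corr-+∣≤ r M h))

∣corr∣≤ : ∀ N h → ∣ corr N h ∣ ≤ N
∣corr∣≤ N h = subst (λ n → ∣ corr n h ∣ ≤ n) (+-identityʳ N) (∣corr-+∣≤ N 0 h)

Σ∣corr∣≤ : ∀ N K → Σ∣corr∣ N K ≤ K * N
Σ∣corr∣≤ N K = ≤-trans (Σ<-mono-≤ K (∣corr∣≤ N)) (≤-reflexive (Σ<-const K N))

Σ∣corr∣-+ : ∀ r M K → Σ∣corr∣ (r + M) K ≤ K * r + Σ∣corr∣ M K
Σ∣corr∣-+ r M K = begin
  Σ∣corr∣ (r + M) K                 ≤⟨ Σ<-mono-≤ K (∣corr-+∣≤ r M) ⟩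
  Σ< K (λ h → r + ∣ corr M h ∣)     ≡⟨ Σ<-distrib-+ K (λ _ → r) (λ h → ∣ corr M h ∣) ⟩
  Σ< K (λ _ → r) + Σ∣corr∣ M K      ≡⟨ cong (_+ Σ∣corr∣ M K) (Σ<-const K r) ⟩
  K * r + Σ∣corr∣ M K               ∎
  where open ≤-Reasoning

N≡N%4+N/4*2*2 : ∀ N → N ≡ N % 4 + N / 4 * 2 * 2
N≡N%4+N/4*2*2 N = trans (m≡m%n+[m/n]*n N 4) (cong (N % 4 +_) (sym (*-assoc (N / 4) 2 2)))

Σ∣corr∣-quarter : ∀ N K → Σ∣corr∣ N (K * 2 * 2) ≤ K * 2 * 2 * 3 + 12 * Σ∣corr∣ (N / 4) (suc K)
Σ∣corr∣-quarter N K = begin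
  Σ∣corr∣ N (K * 2 * 2)                          ≡⟨ cong (λ n → Σ∣corr∣ n (K * 2 * 2)) (N≡N%4+N/4*2*2 N) ⟩
  Σ∣corr∣ (N % 4 + N / 4 * 2 * 2) (K * 2 * 2)    ≤⟨ Σ∣corr∣-+ (N % 4) (N / 4 * 2 * 2) (K * 2 * 2) ⟩
  K * 2 * 2 * (N % 4) + Σ∣corr∣ (N / 4 * 2 * 2) (K * 2 * 2)
    ≤⟨ +-mono-≤ (*-monoʳ-≤ (K * 2 * 2) (s≤s⁻¹ (m%n<n N 4))) (Σ∣corr∣-×4 (N / 4) K) ⟩
  K * 2 * 2 * 3 + 12 * Σ∣corr∣ (N / 4) (suc K)   ∎
  where open ≤-Reasoning

-- The slack 2·4^k + 2 pays for the remainder N % 4 and the extra shift lost at each quartering.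
Σ∣corr∣-4^k : ∀ k N → Σ∣corr∣ N (2 + 4 ^ k) + 2 * 4 ^ k + 2 ≤ 4 * 3 ^ k * (N + 4 ^ k)
Σ∣corr∣-4^k zero    N = ≤-trans (+-monoˡ-≤ 2 (+-monoˡ-≤ 2 (Σ∣corr∣≤ N 3))) (≤-trans (m≤m+n _ N) (≤-reflexive (expand N)))
  where
  expand : ∀ n → 3 * n + 2 + 2 + n ≡ 4 * 1 * (n + 1)
  expand = ℕ-Solver.solve-∀
Σ∣corr∣-4^k (suc k) N = begin
  Σ∣corr∣ N (2 + 4 * X) + 2 * (4 * X) + 2
    ≤⟨ +-monoˡ-≤ 2 (+-monoˡ-≤ (2 * (4 * X)) (Σ<-monoˡ-≤ (λ h → ∣ corr N h ∣) (2+4x≤[1+x]*2*2 X))) ⟩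
  Σ∣corr∣ N (suc X * 2 * 2) + 2 * (4 * X) + 2
    ≤⟨ +-monoˡ-≤ 2 (+-monoˡ-≤ (2 * (4 * X)) (Σ∣corr∣-quarter N (suc X))) ⟩
  suc X * 2 * 2 * 3 + 12 * Σ∣corr∣ M (2 + X) + 2 * (4 * X) + 2
    ≤⟨ absorb (Σ∣corr∣ M (2 + X)) X ⟩
  12 * (Σ∣corr∣ M (2 + X) + 2 * X + 2)
    ≤⟨ *-monoʳ-≤ 12 (Σ∣corr∣-4^k k M) ⟩
  12 * (4 * Y * (M + X))
    ≡⟨ regroup Y M X ⟩
  4 * (3 * Y) * (M * 2 * 2 + 4 * X)
    ≤⟨ *-monoʳ-≤ (4 * (3 * Y)) (+-monoˡ-≤ (4 * X) M*4≤N) ⟩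
  4 * (3 * Y) * (N + 4 * X) ∎
  where
  open ≤-Reasoning
  X Y M : ℕ
  X = 4 ^ k
  Y = 3 ^ k
  M = N / 4
  M*4≤N : M * 2 * 2 ≤ N
  M*4≤N = ≤-trans (m≤n+m (M * 2 * 2) (N % 4)) (≤-reflexive (sym (N≡N%4+N/4*2*2 N)))
  2+4x≤[1+x]*2*2 : ∀ x → 2 + 4 * x ≤ (1 + x) * 2 * 2
  2+4x≤[1+x]*2*2 x = ≤-trans (m≤m+n (2 + 4 * x) 2) (≤-reflexive (expand x))
    where
    expand : ∀ x → 2 + 4 * x + 2 ≡ (1 + x) * 2 * 2
    expand = ℕ-Solver.solve-∀
  absorb : ∀ f x → (1 + x) * 2 * 2 * 3 + 12 * f + 2 * (4 * x) + 2 ≤ 12 * (f + 2 * x + 2)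
  absorb f x = ≤-trans (m≤m+n _ (4 * x + 10)) (≤-reflexive (expand f x))
    where
    expand : ∀ f x → (1 + x) * 2 * 2 * 3 + 12 * f + 2 * (4 * x) + 2 + (4 * x + 10) ≡ 12 * (f + 2 * x + 2)
    expand = ℕ-Solver.solve-∀
  regroup : ∀ y m x → 12 * (4 * y * (m + x)) ≡ 4 * (3 * y) * (m * 2 * 2 + 4 * x)
  regroup = ℕ-Solver.solve-∀

corr-suc : ∀ N h → corr (suc N) h ≡ ε h ℤ.+ S N h
corr-suc zero    h = trans (ℤ.+-identityˡ _) (trans (ℤ.*-identityˡ (ε h)) (sym (ℤ.+-identityʳ (ε h))))
corr-suc (suc N) h = trans (cong (ℤ._+ ε (suc N) ℤ.* ε (suc N + h)) (corr-suc N h)) (ℤ.+-assoc (ε h) (S N h) _)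

∣S∣≤ : ∀ N h → ∣ S N h ∣ ≤ ∣ corr (suc N) h ∣ + 1
∣S∣≤ N h = subst (λ s → ∣ s ∣ ≤ ∣ corr (suc N) h ∣ + 1) S≡corr-ε
  (≤-trans (ℤ.∣i-j∣≤∣i∣+∣j∣ (corr (suc N) h) (ε h)) (≤-reflexive (cong (∣ corr (suc N) h ∣ +_) (∣ε∣≡1 h))))
  where
  cancel : ∀ e s → (e ℤ.+ s) ℤ.- e ≡ s
  cancel = ℤ-Solver.solve-∀
  S≡corr-ε : corr (suc N) h ℤ.- ε h ≡ S N h
  S≡corr-ε = trans (cong (ℤ._- ε h) (corr-suc N h)) (cancel (ε h) (S N h))

T≤Σ∣corr∣ : ∀ N H → T N H ≤ Σ∣corr∣ (suc N) (suc H) + H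
T≤Σ∣corr∣ N zero    = z≤n
T≤Σ∣corr∣ N (suc H) = ≤-trans (+-mono-≤ (T≤Σ∣corr∣ N H) (∣S∣≤ N (suc H)))
  (≤-reflexive (regroup (Σ∣corr∣ (suc N) (suc H)) H ∣ corr (suc N) (suc H) ∣))
  where
  regroup : ∀ s h c → s + h + (c + 1) ≡ s + c + (1 + h)
  regroup = ℕ-Solver.solve-∀

T≤12*3^k*N : ∀ N H k → 4 * H ≤ N → H ≤ 4 ^ k → 4 ^ k ≤ 4 * H → T N H ≤ 12 * 3 ^ k * N
T≤12*3^k*N N H k 4H≤N H≤X X≤4H = begin
  T N H                                       ≤⟨ T≤Σ∣corr∣ N H ⟩
  Σ∣corr∣ (suc N) (suc H) + H                 ≤⟨ +-mono-≤ (Σ<-monoˡ-≤ (λ h → ∣ corr (suc N) h ∣) 1+H≤2+X) H≤2X+2 ⟩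
  Σ∣corr∣ (suc N) (2 + X) + (2 * X + 2)       ≡⟨ +-assoc (Σ∣corr∣ (suc N) (2 + X)) (2 * X) 2 ⟨
  Σ∣corr∣ (suc N) (2 + X) + 2 * X + 2         ≤⟨ Σ∣corr∣-4^k k (suc N) ⟩
  4 * 3 ^ k * (suc N + X)                     ≤⟨ *-monoʳ-≤ (4 * 3 ^ k) (+-mono-≤ (+-monoˡ-≤ N 1≤N) X≤N) ⟩
  4 * 3 ^ k * (N + N + N)                     ≡⟨ regroup (3 ^ k) N ⟩
  12 * 3 ^ k * N                              ∎
  where
  open ≤-Reasoning
  X : ℕ
  X = 4 ^ k
  X≤N : X ≤ N
  X≤N = ≤-trans X≤4H 4H≤N
  1+H≤2+X : suc H ≤ 2 + X
  1+H≤2+X = ≤-trans (s≤s H≤X) (n≤1+n (suc X))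
  H≤2X+2 : H ≤ 2 * X + 2
  H≤2X+2 = ≤-trans H≤X (≤-trans (m≤m+n X (X + 0)) (m≤m+n (2 * X) 2))
  1≤N : 1 ≤ N
  1≤N = ≤-trans (m^n>0 4 k) X≤N
  regroup : ∀ y n → 4 * y * (n + n + n) ≡ 12 * y * n
  regroup = ℕ-Solver.solve-∀

^-distrib-* : ∀ m n o → (m * n) ^ o ≡ m ^ o * n ^ o
^-distrib-* m n zero    = refl
^-distrib-* m n (suc o) = trans (cong (m * n *_) (^-distrib-* m n o)) (*-interchange m n (m ^ o) (n ^ o))

^-swap : ∀ m n o → (m ^ n) ^ o ≡ (m ^ o) ^ n
^-swap m n o = trans (^-*-assoc m n o) (trans (cong (m ^_) (*-comm n o)) (sym (^-*-assoc m o n)))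

7^e<2^[2a+e]⇒3^e<4^a : ∀ a e → 7 ^ e < 2 ^ (2 * a + e) → 3 ^ e < 4 ^ a
7^e<2^[2a+e]⇒3^e<4^a a e 7^e<2^[2a+e] = *-cancelʳ-< (2 ^ e) (3 ^ e) (4 ^ a) (begin-strict
  3 ^ e * 2 ^ e      ≡⟨ ^-distrib-* 3 2 e ⟨
  6 ^ e              ≤⟨ ^-monoˡ-≤ e (n≤1+n 6) ⟩
  7 ^ e              <⟨ 7^e<2^[2a+e] ⟩
  2 ^ (2 * a + e)    ≡⟨ ^-distribˡ-+-* 2 (2 * a) e ⟩
  2 ^ (2 * a) * 2 ^ e ≡⟨ cong (_* 2 ^ e) (^-*-assoc 2 2 a) ⟨
  4 ^ a * 2 ^ e      ∎)
  where open ≤-Reasoning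

[y^k]^e≤x^e*H^a : ∀ {x y} .{{_ : NonZero x}} k a e H .{{_ : NonZero H}} →
  y ≤ x → y ^ e ≤ x ^ a → x ^ k ≤ x * H → (y ^ k) ^ e ≤ x ^ e * H ^ a
[y^k]^e≤x^e*H^a {x} {y} k a e H y≤x y^e≤x^a x^k≤xH with ≤-total a e
... | inj₁ a≤e = begin
  (y ^ k) ^ e    ≡⟨ ^-swap y k e ⟩
  (y ^ e) ^ k    ≤⟨ ^-monoˡ-≤ k y^e≤x^a ⟩
  (x ^ a) ^ k    ≡⟨ ^-swap x a k ⟩
  (x ^ k) ^ a    ≤⟨ ^-monoˡ-≤ a x^k≤xH ⟩
  (x * H) ^ a    ≡⟨ ^-distrib-* x H a ⟩
  x ^ a * H ^ a  ≤⟨ *-monoˡ-≤ (H ^ a) (^-monoʳ-≤ x a≤e) ⟩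
  x ^ e * H ^ a  ∎
  where open ≤-Reasoning
... | inj₂ e≤a = begin
  (y ^ k) ^ e    ≤⟨ ^-monoˡ-≤ e (^-monoˡ-≤ k y≤x) ⟩
  (x ^ k) ^ e    ≤⟨ ^-monoˡ-≤ e x^k≤xH ⟩
  (x * H) ^ e    ≡⟨ ^-distrib-* x H e ⟩
  x ^ e * H ^ e  ≤⟨ *-monoʳ-≤ (x ^ e) (^-monoʳ-≤ H e≤a) ⟩
  x ^ e * H ^ a  ∎
  where open ≤-Reasoning

4^k-bracket : ∀ H → ∃[ k ] (suc H ≤ 4 ^ k × 4 ^ k ≤ 4 * suc H)
4^k-bracket zero = 0 , s≤s z≤n , s≤s z≤n
4^k-bracket (suc H) with 4^k-bracket H
... | k , 1+H≤X , X≤4+4H with 2 + H ≤? 4 ^ k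
...   | yes 2+H≤X = k , 2+H≤X , ≤-trans X≤4+4H (*-monoʳ-≤ 4 (n≤1+n (suc H)))
...   | no  2+H≰X = suc k , subst (λ x → 2 + H ≤ 4 * x) (sym X≡1+H) 2+H≤4+4H
                          , *-monoʳ-≤ 4 (≤-trans (≤-reflexive X≡1+H) (n≤1+n (suc H)))
  where
  X≡1+H : 4 ^ k ≡ suc H
  X≡1+H = ≤-antisym (s≤s⁻¹ (≰⇒> 2+H≰X)) 1+H≤X
  2+H≤4+4H : 2 + H ≤ 4 * suc H
  2+H≤4+4H = ≤-trans (m≤m+n (2 + H) (2 + 3 * H)) (≤-reflexive (expand H))
    where
    expand : ∀ h → 2 + h + (2 + 3 * h) ≡ 4 * (1 + h)
    expand = ℕ-Solver.solve-∀

lemma3 : ∃[ C ] (∀ (N H : ℕ) → 4 * H ≤ N → ∀ (a b : ℕ) →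
             7 ^ suc b < 2 ^ (2 * a + suc b) →
             T N H ^ suc b ≤ (C * N) ^ suc b * H ^ a)
lemma3 = 48 , bound
  where
  bound : ∀ N H → 4 * H ≤ N → ∀ a b → 7 ^ suc b < 2 ^ (2 * a + suc b) → T N H ^ suc b ≤ (48 * N) ^ suc b * H ^ a
  bound N zero    _    _ _ _ = z≤n
  bound N (suc H) 4H≤N a b 7^e<2^[2a+e] with 4^k-bracket H
  ... | k , H≤4^k , 4^k≤4H = begin
    T N (suc H) ^ e                     ≤⟨ ^-monoˡ-≤ e (T≤12*3^k*N N (suc H) k 4H≤N H≤4^k 4^k≤4H) ⟩
    (12 * 3 ^ k * N) ^ e                ≡⟨ trans (^-distrib-* (12 * 3 ^ k) N e) (cong (_* N ^ e) (^-distrib-* 12 (3 ^ k) e)) ⟩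
    12 ^ e * (3 ^ k) ^ e * N ^ e        ≤⟨ *-monoˡ-≤ (N ^ e) (*-monoʳ-≤ (12 ^ e) [3^k]^e≤4^e*H^a) ⟩
    12 ^ e * (4 ^ e * suc H ^ a) * N ^ e ≡⟨ regroup (12 ^ e) (4 ^ e) (suc H ^ a) (N ^ e) ⟩
    12 ^ e * 4 ^ e * N ^ e * suc H ^ a  ≡⟨ cong (_* suc H ^ a) (trans (^-distrib-* 48 N e) (cong (_* N ^ e) (^-distrib-* 12 4 e))) ⟨
    (48 * N) ^ e * suc H ^ a            ∎
    where
    open ≤-Reasoning
    e : ℕ
    e = suc b
    [3^k]^e≤4^e*H^a : (3 ^ k) ^ e ≤ 4 ^ e * suc H ^ a
    [3^k]^e≤4^e*H^a = [y^k]^e≤x^e*H^a k a e (suc H) (n≤1+n 3) (<⇒≤ (7^e<2^[2a+e]⇒3^e<4^a a e 7^e<2^[2a+e])) 4^k≤4H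
    regroup : ∀ u v w z → u * (v * w) * z ≡ u * v * z * w
    regroup = ℕ-Solver.solve-∀
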